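{- Fix $T$ with $1<T<\tfrac43$ and consider the PD process on the $n$-vertex cycle. If $P$ is a maximal induced path of cooperators in $C_0$ on $t$ vertices, where $4<t<n-2$, then every interior vertex of $P$ is a cooperator in $C_s$ for all $s\ge 0$.
   Context: A configuration on a graph $G=(V,E)$ is a map $C:V\to\{0,1\}$; $1$ means cooperator, $0$ means defector. The pay-off $f(a,b)$ to a player with strategy $a$ against strategy $b$ is $f(0,0)=0$, $f(0,1)=T$, $f(1,0)=0$, $f(1,1)=1$. The score of $v$ is $s(v)=\sum_{x\in N(v)} f(C(v),C(x))$. The most successful neighbours of $v$ are the vertices of $N[v]$ of maximum score (defectors taken as most successful in case of a tie between a cooperator and a defector). A vertex is weak if its strategy differs from that of its most successful neighbours; updating a vertex changes its strategy if it is currently weak and does nothing otherwise. PD process: given $C_t$, let $W_t$ be the set of weak vertices; if $W_t=\emptyset$ the process stops. Otherwise a uniformly random ordering of $W_t$ is chosen and the vertices are updated one at a time in that order, each with respect to the current configuration, producing $C_{t+1}$. A maximal induced path of cooperators is a path of consecutive cooperators on the cycle whose two neighbouring vertices outside the path are defectors. -}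

module Defs where

open import Data.Bool using (Bool; true; false; if_then_else_; not; _∧_)
open import Data.Nat as ℕ using (ℕ; zero; suc; NonZero; _∸_)
open import Data.Nat.DivMod using (_mod_)
open import Data.Fin using (Fin; toℕ)
open import Data.Fin.Properties using () renaming (_≟_ to _≟ᶠ_)
open import Data.Rational using (ℚ; 0ℚ; 1ℚ; _+_)
open import Data.Rational.Properties using (_≤?_)
open import Data.List using (List; []; _∷_; foldl)
open import Data.Bool.ListAction using (any; all)
open import Data.List.Relation.Unary.Unique.Propositional using (Unique)
open import Data.List.Membership.Propositional using (_∈_)
open import Relation.Nullary using (does)
open import Relation.Binary.PropositionalEquality using (_≡_)
open import Data.Product using (Σ; _×_)
open import Data.Sum using (_⊎_)
open import Function.Bundles using (_⇔_)

-- Strategies: true = cooperator (1), false = defector (0).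
Config : ℕ → Set
Config n = Fin n → Bool

payoff : ℚ → Bool → Bool → ℚ
payoff T false false = 0ℚ
payoff T false true  = T
payoff T true  false = 0ℚ
payoff T true  true  = 1ℚ

module Cycle (n : ℕ) .{{_ : NonZero n}} where

  shift : Fin n → ℕ → Fin n
  shift v k = (toℕ v ℕ.+ k) mod n

  nxt prv : Fin n → Fin n
  nxt v = shift v 1
  prv v = shift v (n ∸ 1)

  closedNbrs : Fin n → List (Fin n)
  closedNbrs v = v ∷ nxt v ∷ prv v ∷ []

  module _ (T : ℚ) (C : Config n) where

    score : Fin n → ℚ
    score v = payoff T (C v) (C (nxt v)) + payoff T (C v) (C (prv v))

    isMax : Fin n → Fin n → Bool
    isMax v x = all (λ y → does (score y ≤? score x)) (closedNbrs v)

    -- strategy of the most successful neighbours of v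
    -- (defector if some defector in N[v] attains the maximum score)
    bestStrategy : Fin n → Bool
    bestStrategy v = not (any (λ x → not (C x) ∧ isMax v x) (closedNbrs v))

    weak : Fin n → Bool
    weak v = not (does (C v Data.Bool.≟ bestStrategy v))
      where import Data.Bool

    update : Fin n → Config n
    update v = if weak v
               then (λ u → if does (u ≟ᶠ v) then bestStrategy v else C u)
               else C

  updateAll : ℚ → Config n → List (Fin n) → Config n
  updateAll T C σ = foldl (λ D v → update T D v) C σ

  -- one round of the PD process: C' is a possible C_{t+1} given C_t = C
  -- (if there are no weak vertices the process has stopped: C' = C)
  Step : ℚ → Config n → Config n → Set
  Step T C C' =
    ((∀ v → weak T C v ≡ false) × C' ≡ C)
    ⊎ Σ (List (Fin n)) (λ σ →
        Unique σ × (∀ v → (v ∈ σ) ⇔ (weak T C v ≡ true)) × C' ≡ updateAll T C σ)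

  -- D is a possible C_s given C_0 = C (for some choice of orderings)
  ReachIn : ℚ → ℕ → Config n → Config n → Set
  ReachIn T zero    C D = D ≡ C
  ReachIn T (suc s) C D = Σ (Config n) (λ E → Step T C E × ReachIn T s E D)

-- When 1 ≤ T no defector is ever weak on a cycle: a defector next to a cooperator
-- earns at least T, while each of its neighbours, having a defecting neighbour,
-- earns at most T; and a defector among defectors sees only defectors. An interior
-- cooperator of P can only be converted by a defecting neighbour at maximum score,
-- which must be one of the two defectors just outside P. Such a defector earns at
-- most T, but the cooperator two steps further along P (interior, since t > 4) has
-- two cooperating neighbours and earns 2 > T. Hence the two outside defectors and
-- the interior of P are fixed by every update, and so by every run of the process.

module Submission where

open import Defs
open import Data.Bool using (Bool; true; false; not; _∧_; _≟_)
open import Data.Bool.Properties using (T-≡; T-not-≡; T-∧; ¬-not)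
open import Data.Nat using (ℕ; NonZero; _∸_; _+_; _≤_; zero; suc; z≤n; s≤s; s≤s⁻¹; >-nonZero⁻¹) renaming (_<_ to _<ℕ_)
open import Data.Nat.Properties using (+-comm; +-assoc; +-suc; +-identityʳ; n<1+n; <-trans; ≤-antisym; ≮⇒≥; m+[n∸m]≡n; _<?_)
open import Data.Nat.DivMod using (_%_; m%n<n; %-distribˡ-+; m%n%n≡m%n; [m+n]%n≡m%n; m<n⇒m%n≡m)
open import Data.Fin using (Fin; toℕ) renaming (_≟_ to _≟ᶠ_)
open import Data.Fin.Properties using (toℕ-fromℕ<; toℕ-injective; toℕ<n)
open import Data.Integer using (+_)
open import Data.Rational using (ℚ; 0ℚ; 1ℚ; _<_; _/_) renaming (_≤_ to _≤ℚ_; _+_ to _+ℚ_)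
open import Data.Rational.Properties as ℚ using ()
open import Data.List using ([]; _∷_)
open import Data.Bool.ListAction using (any)
open import Data.List.Membership.Propositional using (_∈_; lose; find)
open import Data.List.Relation.Unary.All as All using ()
open import Data.List.Relation.Unary.All.Properties using (all⁺; all⁻)
open import Data.List.Relation.Unary.Any using (here; there)
open import Data.List.Relation.Unary.Any.Properties using (any⁺; any⁻)
open import Relation.Binary.Bundles using (DecTotalOrder)
open import Data.List.Extrema (DecTotalOrder.totalOrder ℚ.≤-decTotalOrder) using (argmax; argmax-sel; f[⊥]≤f[argmax]; f[xs]≤f[argmax])
open import Data.Product using (∃-syntax; _×_; _,_)
open import Data.Sum using (_⊎_; inj₁; inj₂; [_,_]′)
open import Function.Bundles using (Equivalence)
open import Relation.Binary.PropositionalEquality using (_≡_; _≢_; refl; sym; trans; cong; cong₂; subst; module ≡-Reasoning)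
open import Relation.Nullary using (yes; no; does; contradiction)
open import Relation.Nullary.Decidable using (toWitness; dec-true; dec-false)

open Equivalence using (to; from)

module _ {n : ℕ} .{{_ : NonZero n}} where
  open Cycle n

  toℕ-shift : ∀ v k → toℕ (shift v k) ≡ (toℕ v + k) % n
  toℕ-shift v k = toℕ-fromℕ< (m%n<n (toℕ v + k) n)

  [m%n+k]%n≡[m+k]%n : ∀ m k → (m % n + k) % n ≡ (m + k) % n
  [m%n+k]%n≡[m+k]%n m k = begin
    (m % n + k) % n          ≡⟨ %-distribˡ-+ (m % n) k n ⟩
    (m % n % n + k % n) % n  ≡⟨ cong (λ r → (r + k % n) % n) (m%n%n≡m%n m n) ⟩
    (m % n + k % n) % n      ≡⟨ %-distribˡ-+ m k n ⟨
    (m + k) % n              ∎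
    where open ≡-Reasoning

  shift-zero : ∀ v → shift v 0 ≡ v
  shift-zero v = toℕ-injective (trans (toℕ-shift v 0)
    (trans (cong (_% n) (+-identityʳ (toℕ v))) (m<n⇒m%n≡m (toℕ<n v))))

  shift-+ : ∀ v i j → shift (shift v i) j ≡ shift v (i + j)
  shift-+ v i j = toℕ-injective (begin
    toℕ (shift (shift v i) j)   ≡⟨ toℕ-shift (shift v i) j ⟩
    (toℕ (shift v i) + j) % n   ≡⟨ cong (λ r → (r + j) % n) (toℕ-shift v i) ⟩
    ((toℕ v + i) % n + j) % n   ≡⟨ [m%n+k]%n≡[m+k]%n (toℕ v + i) j ⟩
    (toℕ v + i + j) % n         ≡⟨ cong (_% n) (+-assoc (toℕ v) i j) ⟩
    (toℕ v + (i + j)) % n       ≡⟨ toℕ-shift v (i + j) ⟨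
    toℕ (shift v (i + j))       ∎)
    where open ≡-Reasoning

  shift-+n : ∀ v k → shift v (k + n) ≡ shift v k
  shift-+n v k = toℕ-injective (begin
    toℕ (shift v (k + n))   ≡⟨ toℕ-shift v (k + n) ⟩
    (toℕ v + (k + n)) % n   ≡⟨ cong (_% n) (+-assoc (toℕ v) k n) ⟨
    (toℕ v + k + n) % n     ≡⟨ [m+n]%n≡m%n (toℕ v + k) n ⟩
    (toℕ v + k) % n         ≡⟨ toℕ-shift v k ⟨
    toℕ (shift v k)         ∎)
    where open ≡-Reasoning

  nxt-shift : ∀ v k → nxt (shift v k) ≡ shift v (suc k)
  nxt-shift v k = trans (shift-+ v k 1) (cong (shift v) (+-comm k 1))

  prv-shift : ∀ v k → prv (shift v (suc k)) ≡ shift v k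
  prv-shift v k = begin
    prv (shift v (suc k))        ≡⟨ shift-+ v (suc k) (n ∸ 1) ⟩
    shift v (suc k + (n ∸ 1))    ≡⟨ cong (shift v) (+-suc k (n ∸ 1)) ⟨
    shift v (k + suc (n ∸ 1))    ≡⟨ cong (λ m → shift v (k + m)) (m+[n∸m]≡n (>-nonZero⁻¹ n)) ⟩
    shift v (k + n)              ≡⟨ shift-+n v k ⟩
    shift v k                    ∎
    where open ≡-Reasoning

  prv-shift-zero : ∀ v → prv (shift v 0) ≡ shift v (n ∸ 1)
  prv-shift-zero v = shift-+ v 0 (n ∸ 1)

  prv-nxt : ∀ v → prv (nxt v) ≡ v
  prv-nxt v = trans (prv-shift v 0) (shift-zero v)

  nxt-prv : ∀ v → nxt (prv v) ≡ v
  nxt-prv v = begin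
    nxt (shift v (n ∸ 1))    ≡⟨ nxt-shift v (n ∸ 1) ⟩
    shift v (suc (n ∸ 1))    ≡⟨ cong (shift v) (m+[n∸m]≡n (>-nonZero⁻¹ n)) ⟩
    shift v (0 + n)          ≡⟨ shift-+n v 0 ⟩
    shift v 0                ≡⟨ shift-zero v ⟩
    v                        ∎
    where open ≡-Reasoning

  module _ (T : ℚ) (C : Config n) (v : Fin n) where

    isMax-intro : ∀ {x} → (∀ {y} → y ∈ closedNbrs v → score T C y ≤ℚ score T C x) →
                  isMax T C v x ≡ true
    isMax-intro {x} y≤x = to T-≡ (all⁻ (λ y → does (score T C y ℚ.≤? score T C x))
      (All.tabulate (λ {y} y∈ → from T-≡ (dec-true (score T C y ℚ.≤? score T C x) (y≤x y∈)))))

    isMax-beaten : ∀ {x y} → y ∈ closedNbrs v → score T C x < score T C y →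
                   isMax T C v x ≢ true
    isMax-beaten {x} {y} y∈ x<y maxˣ = contradiction (trans (sym y≤x) y≰x) λ ()
      where
      y≤x : does (score T C y ℚ.≤? score T C x) ≡ true
      y≤x = to T-≡ (All.lookup (all⁺ (λ y → does (score T C y ℚ.≤? score T C x)) _ (from T-≡ maxˣ)) y∈)
      y≰x : does (score T C y ℚ.≤? score T C x) ≡ false
      y≰x = dec-false (score T C y ℚ.≤? score T C x) (λ y≤x → ℚ.<-irrefl refl (ℚ.<-≤-trans x<y y≤x))

    isMax-exists : ∃[ m ] m ∈ closedNbrs v × isMax T C v m ≡ true
    isMax-exists = m , m∈ , isMax-intro y≤m
      where
      m : Fin n
      m = argmax (score T C) v (nxt v ∷ prv v ∷ [])
      m∈ : m ∈ closedNbrs v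
      m∈ = [ here , there ]′ (argmax-sel (score T C) v (nxt v ∷ prv v ∷ []))
      y≤m : ∀ {y} → y ∈ closedNbrs v → score T C y ≤ℚ score T C m
      y≤m (here refl) = f[⊥]≤f[argmax] {f = score T C} v (nxt v ∷ prv v ∷ [])
      y≤m (there y∈) = All.lookup (f[xs]≤f[argmax] {f = score T C} v (nxt v ∷ prv v ∷ [])) y∈

    isMaxDefector : Fin n → Bool
    isMaxDefector x = not (C x) ∧ isMax T C v x

    bestStrategy-defector : ∀ {x} → x ∈ closedNbrs v → C x ≡ false → isMax T C v x ≡ true →
                            bestStrategy T C v ≡ false
    bestStrategy-defector x∈ Cx maxˣ =
      cong not (to T-≡ (any⁺ isMaxDefector (lose x∈ (from T-∧ (from T-not-≡ Cx , from T-≡ maxˣ)))))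

    bestStrategy-cooperator : (∀ {x} → x ∈ closedNbrs v → C x ≡ false → isMax T C v x ≢ true) →
                              bestStrategy T C v ≡ true
    bestStrategy-cooperator noDefectorMax = cong not (¬-not noneMax)
      where
      noneMax : any isMaxDefector (closedNbrs v) ≢ true
      noneMax anyMax with find (any⁻ isMaxDefector (closedNbrs v) (from T-≡ anyMax))
      ... | x , x∈ , defectorMax with to T-∧ defectorMax
      ...   | ¬Cx , maxˣ = noDefectorMax x∈ (to T-not-≡ ¬Cx) (to T-≡ maxˣ)

    not-weak : C v ≡ bestStrategy T C v → weak T C v ≡ false
    not-weak eq = cong not (dec-true (C v ≟ bestStrategy T C v) eq)

    cooperator-not-weak : C v ≡ true →
      (∀ {x} → x ∈ closedNbrs v → C x ≡ false → ∃[ y ] y ∈ closedNbrs v × score T C x < score T C y) →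
      weak T C v ≡ false
    cooperator-not-weak Cv beaten = not-weak (trans Cv (sym (bestStrategy-cooperator notMax)))
      where
      notMax : ∀ {x} → x ∈ closedNbrs v → C x ≡ false → isMax T C v x ≢ true
      notMax x∈ Cx with beaten x∈ Cx
      ... | y , y∈ , x<y = isMax-beaten y∈ x<y

  update-not-weak : ∀ T C u {w} → weak T C w ≡ false → update T C u w ≡ C w
  update-not-weak T C u {w} w-strong with weak T C u in u-weak
  ... | false = refl
  ... | true with w ≟ᶠ u
  ...   | yes refl = contradiction (trans (sym u-weak) w-strong) λ ()
  ...   | no _ = refl

  module _ (T : ℚ) (P : Config n → Set) (P-update : ∀ C u → P C → P (update T C u)) where

    updateAll-preserves : ∀ C σ → P C → P (updateAll T C σ)
    updateAll-preserves C []      PC = PC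
    updateAll-preserves C (u ∷ σ) PC = updateAll-preserves (update T C u) σ (P-update C u PC)

    Step-preserves : ∀ {C C′} → Step T C C′ → P C → P C′
    Step-preserves (inj₁ (_ , refl)) PC = PC
    Step-preserves (inj₂ (σ , _ , _ , refl)) PC = updateAll-preserves _ σ PC

    ReachIn-preserves : ∀ s {C D} → ReachIn T s C D → P C → P D
    ReachIn-preserves zero    refl PC = PC
    ReachIn-preserves (suc s) (E , step , reach) PC = ReachIn-preserves s reach (Step-preserves step PC)

  module _ {T : ℚ} (1≤T : 1ℚ ≤ℚ T) where

    0≤1 : 0ℚ ≤ℚ 1ℚ
    0≤1 = toWitness {a? = 0ℚ ℚ.≤? 1ℚ} _

    0≤T : 0ℚ ≤ℚ T
    0≤T = ℚ.≤-trans 0≤1 1≤T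

    payoff-≤ : ∀ a b → payoff T a b ≤ℚ T
    payoff-≤ false false = 0≤T
    payoff-≤ false true  = ℚ.≤-refl
    payoff-≤ true  false = 0≤T
    payoff-≤ true  true  = 1≤T

    payoff-nonneg : ∀ a b → 0ℚ ≤ℚ payoff T a b
    payoff-nonneg false false = ℚ.≤-refl
    payoff-nonneg false true  = 0≤T
    payoff-nonneg true  false = ℚ.≤-refl
    payoff-nonneg true  true  = 0≤1

    payoff-vs-defector : ∀ a → payoff T a false ≡ 0ℚ
    payoff-vs-defector false = refl
    payoff-vs-defector true  = refl

    score-≤-T : ∀ C x → C (nxt x) ≡ false ⊎ C (prv x) ≡ false → score T C x ≤ℚ T
    score-≤-T C x (inj₁ Cn) = begin
      payoff T (C x) (C (nxt x)) +ℚ payoff T (C x) (C (prv x))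
        ≡⟨ cong (λ b → payoff T (C x) b +ℚ payoff T (C x) (C (prv x))) Cn ⟩
      payoff T (C x) false +ℚ payoff T (C x) (C (prv x))
        ≡⟨ cong (_+ℚ payoff T (C x) (C (prv x))) (payoff-vs-defector (C x)) ⟩
      0ℚ +ℚ payoff T (C x) (C (prv x))
        ≡⟨ ℚ.+-identityˡ _ ⟩
      payoff T (C x) (C (prv x))
        ≤⟨ payoff-≤ (C x) (C (prv x)) ⟩
      T ∎
      where open ℚ.≤-Reasoning
    score-≤-T C x (inj₂ Cp) = begin
      payoff T (C x) (C (nxt x)) +ℚ payoff T (C x) (C (prv x))
        ≡⟨ cong (λ b → payoff T (C x) (C (nxt x)) +ℚ payoff T (C x) b) Cp ⟩
      payoff T (C x) (C (nxt x)) +ℚ payoff T (C x) false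
        ≡⟨ cong (payoff T (C x) (C (nxt x)) +ℚ_) (payoff-vs-defector (C x)) ⟩
      payoff T (C x) (C (nxt x)) +ℚ 0ℚ
        ≡⟨ ℚ.+-identityʳ _ ⟩
      payoff T (C x) (C (nxt x))
        ≤⟨ payoff-≤ (C x) (C (nxt x)) ⟩
      T ∎
      where open ℚ.≤-Reasoning

    T-≤-score : ∀ C d → C d ≡ false → C (nxt d) ≡ true ⊎ C (prv d) ≡ true → T ≤ℚ score T C d
    T-≤-score C d Cd (inj₁ Cn) = begin
      T                                                 ≡⟨ ℚ.+-identityʳ T ⟨
      T +ℚ 0ℚ                                           ≤⟨ ℚ.+-monoʳ-≤ T (payoff-nonneg false (C (prv d))) ⟩
      payoff T false true +ℚ payoff T false (C (prv d)) ≡⟨ cong₂ (λ a b → payoff T a b +ℚ payoff T a (C (prv d))) Cd Cn ⟨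
      score T C d                                       ∎
      where open ℚ.≤-Reasoning
    T-≤-score C d Cd (inj₂ Cp) = begin
      T                                                 ≡⟨ ℚ.+-identityˡ T ⟨
      0ℚ +ℚ T                                           ≤⟨ ℚ.+-monoˡ-≤ T (payoff-nonneg false (C (nxt d))) ⟩
      payoff T false (C (nxt d)) +ℚ payoff T false true ≡⟨ cong₂ (λ a b → payoff T a (C (nxt d)) +ℚ payoff T a b) Cd Cp ⟨
      score T C d                                       ∎
      where open ℚ.≤-Reasoning

    defector-beside-cooperator-isMax : ∀ C d → C d ≡ false → C (nxt d) ≡ true ⊎ C (prv d) ≡ true →
                                       isMax T C d d ≡ true
    defector-beside-cooperator-isMax C d Cd beside = isMax-intro T C d y≤d
      where
      T≤d = T-≤-score C d Cd beside
      y≤d : ∀ {y} → y ∈ closedNbrs d → score T C y ≤ℚ score T C d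
      y≤d (here refl) = ℚ.≤-refl
      y≤d (there (here refl)) =
        ℚ.≤-trans (score-≤-T C (nxt d) (inj₂ (trans (cong C (prv-nxt d)) Cd))) T≤d
      y≤d (there (there (here refl))) =
        ℚ.≤-trans (score-≤-T C (prv d) (inj₁ (trans (cong C (nxt-prv d)) Cd))) T≤d

    defector-not-weak : ∀ C d → C d ≡ false → weak T C d ≡ false
    defector-not-weak C d Cd = not-weak T C d (trans Cd (sym best))
      where
      best : bestStrategy T C d ≡ false
      best = by-neighbours (C (nxt d)) (C (prv d)) refl refl
        where
        by-neighbours : ∀ bₙ bₚ → C (nxt d) ≡ bₙ → C (prv d) ≡ bₚ → bestStrategy T C d ≡ false
        by-neighbours true  _    Cn _  = bestStrategy-defector T C d (here refl) Cd
                                           (defector-beside-cooperator-isMax C d Cd (inj₁ Cn))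
        by-neighbours false true _  Cp = bestStrategy-defector T C d (here refl) Cd
                                           (defector-beside-cooperator-isMax C d Cd (inj₂ Cp))
        by-neighbours false false Cn Cp =
          let m , m∈ , maxᵐ = isMax-exists T C d in bestStrategy-defector T C d m∈ (defector m∈) maxᵐ
          where
          defector : ∀ {x} → x ∈ closedNbrs d → C x ≡ false
          defector (here refl) = Cd
          defector (there (here refl)) = Cn
          defector (there (there (here refl))) = Cp

  module _ (a : Fin n) (t : ℕ) where

    -- P consists of the vertices shift a k for k < t; only its interior
    -- 1 ≤ k ≤ t ∸ 2 is invariant, the two end vertices of P may defect.
    record CooperatorPath (C : Config n) : Set where
      field
        left-defector  : C (shift a (n ∸ 1)) ≡ false
        right-defector : C (shift a t) ≡ false
        interior       : ∀ k → 1 ≤ k → suc k <ℕ t → C (shift a k) ≡ true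

    module _ {T : ℚ} (1≤T : 1ℚ ≤ℚ T) (T<2 : T < 1ℚ +ℚ 1ℚ) (4<t : 4 <ℕ t) where

      module _ {C : Config n} (path : CooperatorPath C) where
        open CooperatorPath path

        score-deep-interior : ∀ k → 1 ≤ k → 3 + k <ℕ t → score T C (shift a (suc k)) ≡ 1ℚ +ℚ 1ℚ
        score-deep-interior k 1≤k 3+k<t =
          cong₂ _+ℚ_ (cong₂ (payoff T) C-mid C-next) (cong₂ (payoff T) C-mid C-prev)
          where
          C-prev : C (prv (shift a (suc k))) ≡ true
          C-prev = trans (cong C (prv-shift a k))
                         (interior k 1≤k (<-trans (n<1+n _) (<-trans (n<1+n _) 3+k<t)))
          C-mid : C (shift a (suc k)) ≡ true
          C-mid = interior (suc k) (s≤s z≤n) (<-trans (n<1+n _) 3+k<t)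
          C-next : C (nxt (shift a (suc k))) ≡ true
          C-next = trans (cong C (nxt-shift a (suc k))) (interior (suc (suc k)) (s≤s z≤n) 3+k<t)

        left-end-beaten : score T C (prv (shift a 1)) < score T C (nxt (shift a 1))
        left-end-beaten = begin-strict
          score T C (prv (shift a 1))   ≡⟨ cong (score T C) (prv-shift a 0) ⟩
          score T C (shift a 0)         ≤⟨ score-≤-T 1≤T C (shift a 0) (inj₂ C-outside) ⟩
          T                             <⟨ T<2 ⟩
          1ℚ +ℚ 1ℚ                      ≡⟨ score-deep-interior 1 (s≤s z≤n) 4<t ⟨
          score T C (shift a 2)         ≡⟨ cong (score T C) (nxt-shift a 1) ⟨
          score T C (nxt (shift a 1))   ∎
          where
          open ℚ.≤-Reasoning
          C-outside : C (prv (shift a 0)) ≡ false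
          C-outside = trans (cong C (prv-shift-zero a)) left-defector

        right-end-beaten : ∀ k → 2 <ℕ k → suc (suc k) ≡ t →
                           score T C (nxt (shift a k)) < score T C (prv (shift a k))
        right-end-beaten (suc (suc (suc i))) (s≤s (s≤s (s≤s z≤n))) k+2≡t = begin-strict
          score T C (nxt (shift a (3 + i)))  ≡⟨ cong (score T C) (nxt-shift a (3 + i)) ⟩
          score T C (shift a (4 + i))        ≤⟨ score-≤-T 1≤T C (shift a (4 + i)) (inj₁ C-next) ⟩
          T                                  <⟨ T<2 ⟩
          1ℚ +ℚ 1ℚ                           ≡⟨ score-deep-interior (suc i) (s≤s z≤n) 4+i<t ⟨
          score T C (shift a (2 + i))        ≡⟨ cong (score T C) (prv-shift a (2 + i)) ⟨
          score T C (prv (shift a (3 + i)))  ∎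
          where
          open ℚ.≤-Reasoning
          C-next : C (nxt (shift a (4 + i))) ≡ false
          C-next = trans (cong C (nxt-shift a (4 + i)))
                         (subst (λ m → C (shift a m) ≡ false) (sym k+2≡t) right-defector)
          4+i<t : 4 + i <ℕ t
          4+i<t = subst (4 + i <ℕ_) k+2≡t (n<1+n _)

        prv-defector-beaten : ∀ k → 1 ≤ k → suc k <ℕ t → C (prv (shift a k)) ≡ false →
                              score T C (prv (shift a k)) < score T C (nxt (shift a k))
        prv-defector-beaten (suc zero)    _ _ _ = left-end-beaten
        prv-defector-beaten (suc (suc j)) _ k+1<t C-prv = contradiction
          (trans (sym C-prv) (trans (cong C (prv-shift a (suc j)))
                                    (interior (suc j) (s≤s z≤n) (<-trans (n<1+n _) k+1<t))))
          λ ()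

        nxt-defector-beaten : ∀ k → suc k <ℕ t → C (nxt (shift a k)) ≡ false →
                              score T C (nxt (shift a k)) < score T C (prv (shift a k))
        nxt-defector-beaten k k+1<t C-nxt with suc (suc k) <? t
        ... | yes k+2<t = contradiction
          (trans (sym C-nxt) (trans (cong C (nxt-shift a k)) (interior (suc k) (s≤s z≤n) k+2<t)))
          λ ()
        ... | no k+2≮t = right-end-beaten k (s≤s⁻¹ (s≤s⁻¹ (subst (4 <ℕ_) (sym k+2≡t) 4<t))) k+2≡t
          where
          k+2≡t : suc (suc k) ≡ t
          k+2≡t = ≤-antisym k+1<t (≮⇒≥ k+2≮t)

        interior-not-weak : ∀ k → 1 ≤ k → suc k <ℕ t → weak T C (shift a k) ≡ false
        interior-not-weak k 1≤k k+1<t = cooperator-not-weak T C (shift a k) (interior k 1≤k k+1<t) beaten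
          where
          beaten : ∀ {x} → x ∈ closedNbrs (shift a k) → C x ≡ false →
                   ∃[ y ] y ∈ closedNbrs (shift a k) × score T C x < score T C y
          beaten (here refl) Cx = contradiction (trans (sym Cx) (interior k 1≤k k+1<t)) λ ()
          beaten (there (here refl)) Cx =
            prv (shift a k) , there (there (here refl)) , nxt-defector-beaten k k+1<t Cx
          beaten (there (there (here refl))) Cx =
            nxt (shift a k) , there (here refl) , prv-defector-beaten k 1≤k k+1<t Cx

      CooperatorPath-update : ∀ C u → CooperatorPath C → CooperatorPath (update T C u)
      CooperatorPath-update C u path = record
        { left-defector  = kept left-defector
        ; right-defector = kept right-defector
        ; interior       = λ k 1≤k k+1<t →
            trans (update-not-weak T C u (interior-not-weak path k 1≤k k+1<t)) (interior k 1≤k k+1<t)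
        }
        where
        open CooperatorPath path
        kept : ∀ {d} → C d ≡ false → update T C u d ≡ false
        kept Cd = trans (update-not-weak T C u (defector-not-weak 1≤T C _ Cd)) Cd

lemma4p2 : (T : ℚ) → 1ℚ < T → T < (+ 4) / 3 →
    (n : ℕ) .{{_ : NonZero n}} → (C₀ : Config n) → (a : Fin n) → (t : ℕ) →
    4 <ℕ t → t <ℕ n ∸ 2 →
    (∀ k → k <ℕ t → C₀ (Cycle.shift n a k) ≡ true) →
    C₀ (Cycle.shift n a (n ∸ 1)) ≡ false →
    C₀ (Cycle.shift n a t) ≡ false →
    ∀ (s : ℕ) (Cₛ : Config n) → Cycle.ReachIn n T s C₀ Cₛ →
    ∀ k → 1 ≤ k → k + 1 <ℕ t → Cₛ (Cycle.shift n a k) ≡ true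
lemma4p2 T 1<T T<4/3 n C₀ a t 4<t _ C₀-path C₀-left C₀-right s Cₛ reach k 1≤k k+1<t =
  CooperatorPath.interior pathₛ k 1≤k (subst (_<ℕ t) (+-comm k 1) k+1<t)
  where
  T<2 : T < 1ℚ +ℚ 1ℚ
  T<2 = ℚ.<-trans T<4/3 (toWitness {a? = (+ 4) / 3 ℚ.<? 1ℚ +ℚ 1ℚ} _)
  path₀ : CooperatorPath a t C₀
  path₀ = record
    { left-defector  = C₀-left
    ; right-defector = C₀-right
    ; interior       = λ k _ k+1<t → C₀-path k (<-trans (n<1+n k) k+1<t)
    }
  pathₛ : CooperatorPath a t Cₛ
  pathₛ = ReachIn-preserves T (CooperatorPath a t)
            (CooperatorPath-update a t (ℚ.<⇒≤ 1<T) T<2 4<t) s reach path₀
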